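{- We have $$\sum_{\pi\in\mathcal{P}(132)}x^{|\pi|}y^{\mathrm{rmax}(\pi)} = 1 + \frac{xy(1-x-x^2)}{(1-xy-x^2y)(1-2x-x^2)}.$$
   Context: $S_n$ is the set of permutations of $\{1,\dots,n\}$ in one-line notation. A permutation avoids a pattern $\sigma\in S_k$ if it has no subsequence of length $k$ whose entries are in the same relative order as $\sigma$. $\mathcal{P}_n(132)$ is the set of permutations in $S_n$ avoiding each of $132$, $2341$, $3241$ (equivalently, the two-stack sortable permutations avoiding $132$), $\mathcal{P}_0(132)$ contains only the empty permutation, and $\mathcal{P}(132)=\bigcup_{n\ge0}\mathcal{P}_n(132)$. $|\pi|$ is the length of $\pi$, and $\mathrm{rmax}(\pi)$ is the number of right-to-left maxima of $\pi$ (positions $i$ with $\pi(i)>\pi(j)$ for all $j>i$). -}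

module Defs where

open import Data.Bool using (Bool; true; false; _∧_; not; if_then_else_)
open import Data.Nat using (ℕ; zero; suc; _<ᵇ_; _≡ᵇ_; _∸_)
open import Data.Integer using (ℤ; +_) renaming (_+_ to _+ℤ_; _*_ to _*ℤ_; _-_ to _-ℤ_)
open import Data.List using (List; []; _∷_; [_]; _++_; map; concatMap; length; zipWith; upTo; foldr; filterᵇ)
open import Data.Bool.ListAction using (and; all; any)
open import Data.Product using (_×_; _,_)

-- Permutations of {0,…,n-1} in one-line notation, as lists.
-- (0-based values; pattern containment only depends on relative order.)

insertions : ℕ → List ℕ → List (List ℕ)
insertions x []       = [ x ∷ [] ]
insertions x (y ∷ ys) = (x ∷ y ∷ ys) ∷ map (y ∷_) (insertions x ys)

perms : ℕ → List (List ℕ)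
perms zero    = [ [] ]
perms (suc n) = concatMap (insertions n) (perms n)

subseqs : List ℕ → List (List ℕ)
subseqs []       = [ [] ]
subseqs (x ∷ xs) = map (x ∷_) (subseqs xs) ++ subseqs xs

pairs : List ℕ → List (ℕ × ℕ)
pairs []       = []
pairs (x ∷ xs) = map (x ,_) xs ++ pairs xs

_==B_ : Bool → Bool → Bool
true  ==B b = b
false ==B b = not b

-- for lists of equal length: same relative order of every pair of entries
sameOrder : List ℕ → List ℕ → Bool
sameOrder σ s = and (zipWith (λ { (a , b) (c , d) → (a <ᵇ b) ==B (c <ᵇ d) }) (pairs σ) (pairs s))

contains : List ℕ → List ℕ → Bool
contains σ π = any (λ s → (length s ≡ᵇ length σ) ∧ sameOrder σ s) (subseqs π)

avoids : List ℕ → List ℕ → Bool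
avoids π σ = not (contains σ π)

inP132 : List ℕ → Bool
inP132 π = avoids π (1 ∷ 3 ∷ 2 ∷ []) ∧ avoids π (2 ∷ 3 ∷ 4 ∷ 1 ∷ []) ∧ avoids π (3 ∷ 2 ∷ 4 ∷ 1 ∷ [])

rmax : List ℕ → ℕ
rmax []       = 0
rmax (x ∷ xs) = (if all (λ y → y <ᵇ x) xs then 1 else 0) Data.Nat.+ rmax xs

a : ℕ → ℕ → ℕ
a n k = length (filterᵇ (λ π → inP132 π ∧ (rmax π ≡ᵇ k)) (perms n))

-- Formal power series in x, y with integer coefficients:
-- f n k is the coefficient of x^n y^k.

Ser : Set
Ser = ℕ → ℕ → ℤ

sumℤ : List ℤ → ℤ
sumℤ = foldr _+ℤ_ (+ 0)

𝟙 : Ser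
𝟙 zero zero = + 1
𝟙 _    _    = + 0

X : Ser
X (suc zero) zero = + 1
X _          _    = + 0

Y : Ser
Y zero (suc zero) = + 1
Y _    _          = + 0

infixl 6 _⊕_ _⊖_
infixl 7 _⊛_

_⊕_ : Ser → Ser → Ser
(f ⊕ g) n k = f n k +ℤ g n k

_⊖_ : Ser → Ser → Ser
(f ⊖ g) n k = f n k -ℤ g n k

_⊛_ : Ser → Ser → Ser
(f ⊛ g) n k = sumℤ (map (λ i → sumℤ (map (λ j → f i j *ℤ g (n ∸ i) (k ∸ j)) (upTo (suc k)))) (upTo (suc n)))

F : Ser
F n k = + (a n k)

{-# OPTIONS --safe #-}
-- Every permutation arises exactly once by inserting its largest entry n into a permutation
-- σ of {0,…,n-1}. The patterns 132, 2341, 3241 neither begin nor end with their largest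
-- entry, nor begin with their two largest entries, so inserting n in front of σ, at its end,
-- or right after a leading maximum of σ leaves membership in P(132) unchanged, while every
-- other insertion creates one of the patterns. These three insertions shift (|π|, rmax π) by
-- (1, 1), set rmax to 1, and shift by (2, 1) respectively, so the series G = F - 1 of the
-- nonempty permutations satisfies  (1 - xy - x²y) G = xy T  with T = Σ |P_n(132)| xⁿ; the
-- same decomposition gives |P_{n+3}| = 2|P_{n+2}| + |P_{n+1}|, i.e.  (1 - 2x - x²) T = 1 - x - x².
module Submission where

open import Defs
open import Relation.Binary.PropositionalEquality using (_≡_)
open import Data.Nat using (ℕ)

module PowerSeries where

  open import Data.Nat using (zero; suc; _∸_)
  open import Data.Integer using (ℤ; +_; _+_; _-_; _*_)
  open import Data.Integer.Properties using (*-distribʳ-+; *-identityˡ; +-identityˡ; +-identityʳ)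
  open import Data.Integer.Tactic.RingSolver using (solve-∀)
  open import Data.List using (List; []; _∷_; map; upTo)
  open import Data.List.Properties using (map-cong; map-upTo; map-applyUpTo)
  open import Function using (_∘_)
  open import Relation.Binary.Bundles using (Setoid)
  import Relation.Binary.Reasoning.Setoid
  open import Relation.Binary.PropositionalEquality using (refl; sym; trans; cong; cong₂)

  infix 4 _≈_

  _≈_ : Ser → Ser → Set
  f ≈ g = ∀ n k → f n k ≡ g n k

  ≈-setoid : Setoid _ _
  ≈-setoid = record
    { Carrier = Ser
    ; _≈_ = _≈_
    ; isEquivalence = record
      { refl = λ _ _ → refl
      ; sym = λ f≈g n k → sym (f≈g n k)
      ; trans = λ f≈g g≈h n k → trans (f≈g n k) (g≈h n k)
      }
    }

  open Setoid ≈-setoid public using () renaming (refl to ≈-refl; sym to ≈-sym; trans to ≈-trans)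

  module ≈-Reasoning = Relation.Binary.Reasoning.Setoid ≈-setoid

  ⊕-cong : ∀ {f f′ g g′} → f ≈ f′ → g ≈ g′ → f ⊕ g ≈ f′ ⊕ g′
  ⊕-cong f≈f′ g≈g′ n k = cong₂ _+_ (f≈f′ n k) (g≈g′ n k)

  ⊖-cong : ∀ {f f′ g g′} → f ≈ f′ → g ≈ g′ → f ⊖ g ≈ f′ ⊖ g′
  ⊖-cong f≈f′ g≈g′ n k = cong₂ _-_ (f≈f′ n k) (g≈g′ n k)

  mulX : Ser → Ser
  mulX f zero    k = + 0
  mulX f (suc n) k = f n k

  mulY : Ser → Ser
  mulY f n zero    = + 0
  mulY f n (suc k) = f n k

  mulX-cong : ∀ {f g} → f ≈ g → mulX f ≈ mulX g
  mulX-cong f≈g zero    k = refl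
  mulX-cong f≈g (suc n) k = f≈g n k

  mulY-cong : ∀ {f g} → f ≈ g → mulY f ≈ mulY g
  mulY-cong f≈g n zero    = refl
  mulY-cong f≈g n (suc k) = f≈g n k

  sumℤ-map-+ : ∀ {A : Set} (f g : A → ℤ) (xs : List A) →
    sumℤ (map (λ x → f x + g x) xs) ≡ sumℤ (map f xs) + sumℤ (map g xs)
  sumℤ-map-+ f g []       = refl
  sumℤ-map-+ f g (x ∷ xs) =
    trans (cong (_+_ (f x + g x)) (sumℤ-map-+ f g xs)) (interchange (f x) (g x) _ _)
    where
    interchange : ∀ a b c d → a + b + (c + d) ≡ a + c + (b + d)
    interchange = solve-∀

  sumℤ-map-minus : ∀ {A : Set} (f g : A → ℤ) (xs : List A) →
    sumℤ (map (λ x → f x - g x) xs) ≡ sumℤ (map f xs) - sumℤ (map g xs)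
  sumℤ-map-minus f g []       = refl
  sumℤ-map-minus f g (x ∷ xs) =
    trans (cong (_+_ (f x - g x)) (sumℤ-map-minus f g xs)) (interchange (f x) (g x) _ _)
    where
    interchange : ∀ a b c d → a - b + (c - d) ≡ a + c - (b + d)
    interchange = solve-∀

  sumℤ-map-zero : ∀ {A : Set} (f : A → ℤ) (xs : List A) → (∀ x → f x ≡ + 0) → sumℤ (map f xs) ≡ + 0
  sumℤ-map-zero f []       f≡0 = refl
  sumℤ-map-zero f (x ∷ xs) f≡0 = cong₂ _+_ (f≡0 x) (sumℤ-map-zero f xs f≡0)

  sumℤ-map-cong : ∀ {A : Set} (f g : A → ℤ) (xs : List A) → (∀ x → f x ≡ g x) → sumℤ (map f xs) ≡ sumℤ (map g xs)
  sumℤ-map-cong f g xs f≡g = cong sumℤ (map-cong f≡g xs)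

  sumℤ-upTo-suc : ∀ (f : ℕ → ℤ) m → sumℤ (map f (upTo (suc m))) ≡ f 0 + sumℤ (map (f ∘ suc) (upTo m))
  sumℤ-upTo-suc f m =
    cong (λ xs → f 0 + sumℤ xs) (trans (map-applyUpTo suc f m) (sym (map-upTo (f ∘ suc) m)))

  sumℤ-upTo-suc-zero : ∀ (f : ℕ → ℤ) m → f 0 ≡ + 0 → sumℤ (map f (upTo (suc m))) ≡ sumℤ (map (f ∘ suc) (upTo m))
  sumℤ-upTo-suc-zero f m f0≡0 =
    trans (sumℤ-upTo-suc f m) (trans (cong (_+ sumℤ (map (f ∘ suc) (upTo m))) f0≡0) (+-identityˡ _))

  -- (f ⊛ g) n k  is definitionally  ΣΣ n k (summand f g n k)
  row : ℕ → (ℕ → ℕ → ℤ) → ℕ → ℤ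
  row k φ i = sumℤ (map (φ i) (upTo (suc k)))

  ΣΣ : ℕ → ℕ → (ℕ → ℕ → ℤ) → ℤ
  ΣΣ n k φ = sumℤ (map (row k φ) (upTo (suc n)))

  summand : Ser → Ser → ℕ → ℕ → ℕ → ℕ → ℤ
  summand f g n k i j = f i j * g (n ∸ i) (k ∸ j)

  ΣΣ-cong : ∀ n k (φ ψ : ℕ → ℕ → ℤ) → (∀ i j → φ i j ≡ ψ i j) → ΣΣ n k φ ≡ ΣΣ n k ψ
  ΣΣ-cong n k φ ψ φ≡ψ =
    sumℤ-map-cong (row k φ) (row k ψ) (upTo (suc n)) (λ i → sumℤ-map-cong (φ i) (ψ i) (upTo (suc k)) (φ≡ψ i))

  ΣΣ-+ : ∀ n k (φ ψ : ℕ → ℕ → ℤ) → ΣΣ n k (λ i j → φ i j + ψ i j) ≡ ΣΣ n k φ + ΣΣ n k ψ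
  ΣΣ-+ n k φ ψ = trans
    (sumℤ-map-cong _ (λ i → row k φ i + row k ψ i) (upTo (suc n)) (λ i → sumℤ-map-+ (φ i) (ψ i) (upTo (suc k))))
    (sumℤ-map-+ (row k φ) (row k ψ) (upTo (suc n)))

  ΣΣ-minus : ∀ n k (φ ψ : ℕ → ℕ → ℤ) → ΣΣ n k (λ i j → φ i j - ψ i j) ≡ ΣΣ n k φ - ΣΣ n k ψ
  ΣΣ-minus n k φ ψ = trans
    (sumℤ-map-cong _ (λ i → row k φ i - row k ψ i) (upTo (suc n)) (λ i → sumℤ-map-minus (φ i) (ψ i) (upTo (suc k))))
    (sumℤ-map-minus (row k φ) (row k ψ) (upTo (suc n)))

  ⊛-congˡ : ∀ {f g} h → f ≈ g → f ⊛ h ≈ g ⊛ h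
  ⊛-congˡ {f} {g} h f≈g n k =
    ΣΣ-cong n k (summand f h n k) (summand g h n k) (λ i j → cong (_* h (n ∸ i) (k ∸ j)) (f≈g i j))

  ⊛-distribʳ-⊕ : ∀ f g h → (f ⊕ g) ⊛ h ≈ f ⊛ h ⊕ g ⊛ h
  ⊛-distribʳ-⊕ f g h n k = trans
    (ΣΣ-cong n k (summand (f ⊕ g) h n k) _ (λ i j → *-distribʳ-+ (h (n ∸ i) (k ∸ j)) (f i j) (g i j)))
    (ΣΣ-+ n k (summand f h n k) (summand g h n k))

  ⊛-distribʳ-⊖ : ∀ f g h → (f ⊖ g) ⊛ h ≈ f ⊛ h ⊖ g ⊛ h
  ⊛-distribʳ-⊖ f g h n k = trans
    (ΣΣ-cong n k (summand (f ⊖ g) h n k) _ (λ i j → distrib (f i j) (g i j) (h (n ∸ i) (k ∸ j))))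
    (ΣΣ-minus n k (summand f h n k) (summand g h n k))
    where
    distrib : ∀ a b c → (a - b) * c ≡ a * c - b * c
    distrib = solve-∀

  ⊛-identityˡ : ∀ h → 𝟙 ⊛ h ≈ h
  ⊛-identityˡ h n k =
    trans (sumℤ-upTo-suc (row k (summand 𝟙 h n k)) n) (trans (cong₂ _+_ unit-row zero-rows) (+-identityʳ _))
    where
    unit-row : row k (summand 𝟙 h n k) 0 ≡ h n k
    unit-row = trans (sumℤ-upTo-suc (summand 𝟙 h n k 0) k)
      (trans (cong₂ _+_ (*-identityˡ (h n k)) (sumℤ-map-zero _ (upTo k) (λ _ → refl))) (+-identityʳ _))
    zero-rows : sumℤ (map (row k (summand 𝟙 h n k) ∘ suc) (upTo n)) ≡ + 0
    zero-rows = sumℤ-map-zero _ (upTo n) (λ _ → sumℤ-map-zero _ (upTo (suc k)) (λ _ → refl))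

  mulX-⊛ : ∀ f h → mulX f ⊛ h ≈ mulX (f ⊛ h)
  mulX-⊛ f h zero    k = cong (_+ + 0) (sumℤ-map-zero _ (upTo (suc k)) (λ _ → refl))
  mulX-⊛ f h (suc n) k =
    sumℤ-upTo-suc-zero (row k (summand (mulX f) h (suc n) k)) (suc n) (sumℤ-map-zero _ (upTo (suc k)) (λ _ → refl))

  mulY-⊛ : ∀ f h → mulY f ⊛ h ≈ mulY (f ⊛ h)
  mulY-⊛ f h n zero    = sumℤ-map-zero _ (upTo (suc n)) (λ _ → refl)
  mulY-⊛ f h n (suc k) = sumℤ-map-cong _ _ (upTo (suc n))
    (λ i → sumℤ-upTo-suc-zero (summand (mulY f) h n (suc k) i) (suc k) refl)

  X≈mulX𝟙 : X ≈ mulX 𝟙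
  X≈mulX𝟙 zero          k       = refl
  X≈mulX𝟙 (suc zero)    zero    = refl
  X≈mulX𝟙 (suc zero)    (suc k) = refl
  X≈mulX𝟙 (suc (suc n)) k       = refl

  Y≈mulY𝟙 : Y ≈ mulY 𝟙
  Y≈mulY𝟙 zero    zero          = refl
  Y≈mulY𝟙 zero    (suc zero)    = refl
  Y≈mulY𝟙 zero    (suc (suc k)) = refl
  Y≈mulY𝟙 (suc n) zero          = refl
  Y≈mulY𝟙 (suc n) (suc k)       = refl

  X-⊛ : ∀ h → X ⊛ h ≈ mulX h
  X-⊛ h = ≈-trans (⊛-congˡ h X≈mulX𝟙) (≈-trans (mulX-⊛ 𝟙 h) (mulX-cong (⊛-identityˡ h)))

  Y-⊛ : ∀ h → Y ⊛ h ≈ mulY h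
  Y-⊛ h = ≈-trans (⊛-congˡ h Y≈mulY𝟙) (≈-trans (mulY-⊛ 𝟙 h) (mulY-cong (⊛-identityˡ h)))

  X⊛-⊛ : ∀ f h → (X ⊛ f) ⊛ h ≈ mulX (f ⊛ h)
  X⊛-⊛ f h = ≈-trans (⊛-congˡ h (X-⊛ f)) (mulX-⊛ f h)

  XX-⊛ : ∀ h → (X ⊛ X) ⊛ h ≈ mulX (mulX h)
  XX-⊛ h = ≈-trans (X⊛-⊛ X h) (mulX-cong (X-⊛ h))

  XY-⊛ : ∀ h → (X ⊛ Y) ⊛ h ≈ mulX (mulY h)
  XY-⊛ h = ≈-trans (X⊛-⊛ Y h) (mulX-cong (Y-⊛ h))

  XXY-⊛ : ∀ h → ((X ⊛ X) ⊛ Y) ⊛ h ≈ mulX (mulX (mulY h))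
  XXY-⊛ h = ≈-trans (⊛-congˡ h (X⊛-⊛ X Y)) (≈-trans (mulX-⊛ (X ⊛ Y) h) (mulX-cong (XY-⊛ h)))

  𝟙⊖X⊖X⊛X≈ : 𝟙 ⊖ X ⊖ X ⊛ X ≈ 𝟙 ⊖ mulX 𝟙 ⊖ mulX (mulX 𝟙)
  𝟙⊖X⊖X⊛X≈ = ⊖-cong (⊖-cong (≈-refl {𝟙}) X≈mulX𝟙) (≈-trans (X-⊛ X) (mulX-cong X≈mulX𝟙))

  mulD₁ : Ser → Ser
  mulD₁ h = h ⊖ mulX (mulY h) ⊖ mulX (mulX (mulY h))

  mulD₂ : Ser → Ser
  mulD₂ h = h ⊖ (mulX h ⊕ mulX h) ⊖ mulX (mulX h)

  mulD₁-cong : ∀ {f g} → f ≈ g → mulD₁ f ≈ mulD₁ g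
  mulD₁-cong f≈g = ⊖-cong (⊖-cong f≈g (mulX-cong (mulY-cong f≈g))) (mulX-cong (mulX-cong (mulY-cong f≈g)))

  mulD₂-cong : ∀ {f g} → f ≈ g → mulD₂ f ≈ mulD₂ g
  mulD₂-cong f≈g = ⊖-cong (⊖-cong f≈g (⊕-cong (mulX-cong f≈g) (mulX-cong f≈g))) (mulX-cong (mulX-cong f≈g))

  D₁-⊛ : ∀ h → (𝟙 ⊖ X ⊛ Y ⊖ X ⊛ X ⊛ Y) ⊛ h ≈ mulD₁ h
  D₁-⊛ h = ≈-trans (⊛-distribʳ-⊖ (𝟙 ⊖ X ⊛ Y) (X ⊛ X ⊛ Y) h)
    (⊖-cong (≈-trans (⊛-distribʳ-⊖ 𝟙 (X ⊛ Y) h) (⊖-cong (⊛-identityˡ h) (XY-⊛ h))) (XXY-⊛ h))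

  D₂-⊛ : ∀ h → (𝟙 ⊖ (X ⊕ X) ⊖ X ⊛ X) ⊛ h ≈ mulD₂ h
  D₂-⊛ h = ≈-trans (⊛-distribʳ-⊖ (𝟙 ⊖ (X ⊕ X)) (X ⊛ X) h)
    (⊖-cong (≈-trans (⊛-distribʳ-⊖ 𝟙 (X ⊕ X) h)
                     (⊖-cong (⊛-identityˡ h) (≈-trans (⊛-distribʳ-⊕ X X h) (⊕-cong (X-⊛ h) (X-⊛ h)))))
            (XX-⊛ h))

  mulXY-⊛ : ∀ f h → mulX (mulY f) ⊛ h ≈ mulX (mulY (f ⊛ h))
  mulXY-⊛ f h = ≈-trans (mulX-⊛ (mulY f) h) (mulX-cong (mulY-⊛ f h))

  mulD₁-⊛ : ∀ f h → mulD₁ f ⊛ h ≈ mulD₁ (f ⊛ h)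
  mulD₁-⊛ f h = ≈-trans (⊛-distribʳ-⊖ (f ⊖ mulX (mulY f)) (mulX (mulX (mulY f))) h)
    (⊖-cong (≈-trans (⊛-distribʳ-⊖ f (mulX (mulY f)) h) (⊖-cong (≈-refl {f ⊛ h}) (mulXY-⊛ f h)))
            (≈-trans (mulX-⊛ (mulX (mulY f)) h) (mulX-cong (mulXY-⊛ f h))))

  private
    mulD₂-linear : ∀ a b c d e h → a - b - ((c - d) + (c - d)) - (e - h) ≡ a - (c + c) - e - (b - (d + d) - h)
    mulD₂-linear = solve-∀

  mulD₂-⊖ : ∀ f g → mulD₂ (f ⊖ g) ≈ mulD₂ f ⊖ mulD₂ g
  mulD₂-⊖ f g zero          k = mulD₂-linear (f 0 k) (g 0 k) (+ 0) (+ 0) (+ 0) (+ 0)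
  mulD₂-⊖ f g (suc zero)    k = mulD₂-linear (f 1 k) (g 1 k) (f 0 k) (g 0 k) (+ 0) (+ 0)
  mulD₂-⊖ f g (suc (suc n)) k = mulD₂-linear (f (suc (suc n)) k) (g (suc (suc n)) k) (f (suc n) k) (g (suc n) k) (f n k) (g n k)

  mulD₂-mulX : ∀ f → mulD₂ (mulX f) ≈ mulX (mulD₂ f)
  mulD₂-mulX f zero    k = refl
  mulD₂-mulX f (suc n) k = refl

  mulD₂-mulY : ∀ f → mulD₂ (mulY f) ≈ mulY (mulD₂ f)
  mulD₂-mulY f zero          zero    = refl
  mulD₂-mulY f (suc zero)    zero    = refl
  mulD₂-mulY f (suc (suc n)) zero    = refl
  mulD₂-mulY f zero          (suc k) = refl
  mulD₂-mulY f (suc zero)    (suc k) = refl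
  mulD₂-mulY f (suc (suc n)) (suc k) = refl

  mulD₂-mulXY : ∀ f → mulD₂ (mulX (mulY f)) ≈ mulX (mulY (mulD₂ f))
  mulD₂-mulXY f = ≈-trans (mulD₂-mulX (mulY f)) (mulX-cong (mulD₂-mulY f))

  mulD₂-mulD₁ : ∀ f → mulD₂ (mulD₁ f) ≈ mulD₁ (mulD₂ f)
  mulD₂-mulD₁ f = ≈-trans (mulD₂-⊖ (f ⊖ mulX (mulY f)) (mulX (mulX (mulY f))))
    (⊖-cong (≈-trans (mulD₂-⊖ f (mulX (mulY f))) (⊖-cong (≈-refl {mulD₂ f}) (mulD₂-mulXY f)))
            (≈-trans (mulD₂-mulX (mulX (mulY f))) (mulX-cong (mulD₂-mulXY f))))


module Patterns where

  open import Data.Bool using (Bool; true; false; T; not; _∧_; if_then_else_)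
  open import Data.Bool.ListAction using (all)
  open import Data.Bool.Properties using (T-∧; T-≡; T-not-≡; ∧-zeroʳ)
  open import Data.Empty using (⊥-elim)
  open import Data.List using (List; []; _∷_; _++_; map; length)
  open import Data.List.Membership.Propositional using (_∈_; find; lose)
  open import Data.List.Membership.Propositional.Properties using (∈-map⁺; ∈-map⁻; ∈-++⁺ˡ; ∈-++⁺ʳ; ∈-++⁻)
  open import Data.List.Relation.Binary.Sublist.Propositional using (_⊆_; []; _∷_; _∷ʳ_; minimum; from∈; ⊆-refl; ⊆-trans)
  open import Data.List.Relation.Binary.Sublist.Propositional.Properties using (All-resp-⊆; ++⁺ˡ; ++⁺ʳ)
  open import Data.List.Relation.Unary.All as All using (All; []; _∷_)
  open import Data.List.Relation.Unary.Any using (here)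
  open import Data.List.Relation.Unary.Any.Properties using (any⁺; any⁻)
  open import Data.Nat using (zero; suc; _<_; _≤_; z≤n; s≤s; _<ᵇ_; _≡ᵇ_; _<?_; _+_)
  open import Data.Nat.Properties using (<ᵇ⇒<; <⇒<ᵇ; <-trans; <-asym; <⇒≤; ≤⇒≯; ≮⇒≥)
  open import Data.Product using (∃-syntax; _×_; _,_)
  open import Data.Sum using (_⊎_; inj₁; inj₂)
  open import Function using (Equivalence)
  open import Relation.Binary.PropositionalEquality using (refl; trans; cong; cong₂)
  open import Relation.Nullary using (¬_; yes; no)

  open Equivalence using (to; from)

  T-ext : ∀ {a b : Bool} → (T a → T b) → (T b → T a) → a ≡ b
  T-ext {false} {false} _ _ = refl
  T-ext {false} {true}  _ b⇒a = ⊥-elim (b⇒a _)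
  T-ext {true}  {false} a⇒b _ = ⊥-elim (a⇒b _)
  T-ext {true}  {true}  _ _ = refl

  T-not-<ᵇ⇒≥ : ∀ {m n} → T (not (m <ᵇ n)) → n ≤ m
  T-not-<ᵇ⇒≥ {m}     {zero}  _ = z≤n
  T-not-<ᵇ⇒≥ {suc m} {suc n} t = s≤s (T-not-<ᵇ⇒≥ t)

  ≥⇒T-not-<ᵇ : ∀ {m n} → n ≤ m → T (not (m <ᵇ n))
  ≥⇒T-not-<ᵇ z≤n       = _
  ≥⇒T-not-<ᵇ (s≤s n≤m) = ≥⇒T-not-<ᵇ n≤m

  occurrence : List ℕ → List ℕ → Bool
  occurrence σ s = (length s ≡ᵇ length σ) ∧ sameOrder σ s

  ⊆⇒∈subseqs : ∀ {s π} → s ⊆ π → s ∈ subseqs π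
  ⊆⇒∈subseqs []                    = here refl
  ⊆⇒∈subseqs (refl ∷ s⊆π)          = ∈-++⁺ˡ (∈-map⁺ _ (⊆⇒∈subseqs s⊆π))
  ⊆⇒∈subseqs (_∷ʳ_ {ys = π} x s⊆π) = ∈-++⁺ʳ (map (x ∷_) (subseqs π)) (⊆⇒∈subseqs s⊆π)

  ∈subseqs⇒⊆ : ∀ {s} π → s ∈ subseqs π → s ⊆ π
  ∈subseqs⇒⊆ []      (here refl) = []
  ∈subseqs⇒⊆ (x ∷ π) s∈         with ∈-++⁻ (map (x ∷_) (subseqs π)) s∈
  ... | inj₁ s∈map with ∈-map⁻ (x ∷_) s∈map
  ...   | _ , s′∈ , refl = refl ∷ ∈subseqs⇒⊆ π s′∈
  ∈subseqs⇒⊆ (x ∷ π) s∈ | inj₂ s∈rest = x ∷ʳ ∈subseqs⇒⊆ π s∈rest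

  contains⁺ : ∀ σ {s} π → s ⊆ π → T (occurrence σ s) → T (contains σ π)
  contains⁺ σ π s⊆π occ = any⁺ (occurrence σ) (lose (⊆⇒∈subseqs s⊆π) occ)

  contains⁻ : ∀ σ π → T (contains σ π) → ∃[ s ] s ⊆ π × T (occurrence σ s)
  contains⁻ σ π c with find (any⁻ (occurrence σ) (subseqs π) c)
  ... | s , s∈ , occ = s , ∈subseqs⇒⊆ π s∈ , occ

  contains-deletion : ∀ σ {π π′} → π′ ⊆ π →
    (∀ {s} → s ⊆ π → T (occurrence σ s) → s ⊆ π′) → contains σ π ≡ contains σ π′
  contains-deletion σ {π} {π′} π′⊆π restrict = T-ext
    (λ c → let s , s⊆π , occ = contains⁻ σ π c in contains⁺ σ π′ (restrict s⊆π occ) occ)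
    (λ c → let s , s⊆π′ , occ = contains⁻ σ π′ c in contains⁺ σ π (⊆-trans s⊆π′ π′⊆π) occ)

  ⊆-∷ʳ-split : ∀ {s} (π : List ℕ) n → s ⊆ π ++ n ∷ [] → s ⊆ π ⊎ ∃[ s′ ] s ≡ s′ ++ n ∷ [] × s′ ⊆ π
  ⊆-∷ʳ-split []      n (refl ∷ []) = inj₂ ([] , refl , [])
  ⊆-∷ʳ-split []      n (.n ∷ʳ []) = inj₁ []
  ⊆-∷ʳ-split (x ∷ π) n (refl ∷ s⊆) with ⊆-∷ʳ-split π n s⊆
  ... | inj₁ s⊆π                  = inj₁ (refl ∷ s⊆π)
  ... | inj₂ (s′ , refl , s′⊆π)   = inj₂ (x ∷ s′ , refl , refl ∷ s′⊆π)
  ⊆-∷ʳ-split (x ∷ π) n (.x ∷ʳ s⊆) with ⊆-∷ʳ-split π n s⊆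
  ... | inj₁ s⊆π                  = inj₁ (x ∷ʳ s⊆π)
  ... | inj₂ (s′ , eq , s′⊆π)     = inj₂ (s′ , eq , x ∷ʳ s′⊆π)

  record MaxInsertionInvariant (σ : List ℕ) : Set where
    field
      max-first   : ∀ {n s} → All (_< n) s → ¬ T (occurrence σ (n ∷ s))
      max-last    : ∀ {n s} → All (_< n) s → ¬ T (occurrence σ (s ++ n ∷ []))
      top-two-first : ∀ {y n s} → y < n → All (_< y) s → ¬ T (occurrence σ (y ∷ n ∷ s))

  module _ {σ} (inv : MaxInsertionInvariant σ) where
    open MaxInsertionInvariant inv

    contains-insert-first : ∀ {n π} → All (_< n) π → contains σ (n ∷ π) ≡ contains σ π
    contains-insert-first {n} π<n = contains-deletion σ (n ∷ʳ ⊆-refl) restrict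
      where
      restrict : ∀ {s} → s ⊆ n ∷ _ → T (occurrence σ s) → s ⊆ _
      restrict (refl ∷ s⊆π) occ = ⊥-elim (max-first (All-resp-⊆ s⊆π π<n) occ)
      restrict (_ ∷ʳ s⊆π)   _   = s⊆π

    contains-insert-last : ∀ {n π} → All (_< n) π → contains σ (π ++ n ∷ []) ≡ contains σ π
    contains-insert-last {n} {π} π<n = contains-deletion σ (++⁺ʳ (n ∷ []) ⊆-refl) restrict
      where
      restrict : ∀ {s} → s ⊆ π ++ n ∷ [] → T (occurrence σ s) → s ⊆ π
      restrict s⊆ occ with ⊆-∷ʳ-split π n s⊆
      ... | inj₁ s⊆π                = s⊆π
      ... | inj₂ (s′ , refl , s′⊆π) = ⊥-elim (max-last (All-resp-⊆ s′⊆π π<n) occ)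

    contains-insert-after-max : ∀ {y n π} → y < n → All (_< y) π → contains σ (y ∷ n ∷ π) ≡ contains σ π
    contains-insert-after-max {y} {n} y<n π<y = contains-deletion σ (y ∷ʳ n ∷ʳ ⊆-refl) restrict
      where
      restrict : ∀ {s} → s ⊆ y ∷ n ∷ _ → T (occurrence σ s) → s ⊆ _
      restrict (refl ∷ refl ∷ s⊆π) occ = ⊥-elim (top-two-first y<n (All-resp-⊆ s⊆π π<y) occ)
      restrict (refl ∷ _ ∷ʳ s⊆π)   occ = ⊥-elim (max-first (All-resp-⊆ s⊆π π<y) occ)
      restrict (_ ∷ʳ refl ∷ s⊆π)   occ =
        ⊥-elim (max-first (All-resp-⊆ s⊆π (All.map (λ z<y → <-trans z<y y<n) π<y)) occ)
      restrict (_ ∷ʳ _ ∷ʳ s⊆π)     _   = s⊆π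

  p132 p2341 p3241 : List ℕ
  p132  = 1 ∷ 3 ∷ 2 ∷ []
  p2341 = 2 ∷ 3 ∷ 4 ∷ 1 ∷ []
  p3241 = 3 ∷ 2 ∷ 4 ∷ 1 ∷ []

  ∧⁻ : ∀ {x y} → T (x ∧ y) → T x × T y
  ∧⁻ = to T-∧

  ∧⁺ : ∀ {x y} → T x → T y → T (x ∧ y)
  ∧⁺ tx ty = from T-∧ (tx , ty)

  occurrence132⇒ : ∀ a b c → T (occurrence p132 (a ∷ b ∷ c ∷ [])) → a < b × a < c × c ≤ b
  occurrence132⇒ a b c occ =
    let ab , occ₁ = ∧⁻ occ; ac , occ₂ = ∧⁻ occ₁; cb , _ = ∧⁻ occ₂
    in <ᵇ⇒< a b ab , <ᵇ⇒< a c ac , T-not-<ᵇ⇒≥ cb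

  occurrence132⇐ : ∀ {a b c} → a < b → a < c → c ≤ b → T (occurrence p132 (a ∷ b ∷ c ∷ []))
  occurrence132⇐ a<b a<c c≤b = ∧⁺ (<⇒<ᵇ a<b) (∧⁺ (<⇒<ᵇ a<c) (∧⁺ (≥⇒T-not-<ᵇ c≤b) _))

  -- 2341 and 3241 differ only in the order of their first two entries
  occurrence4⇒ : ∀ a b c d {x rest} → T (x ∧ (a <ᵇ c) ∧ not (a <ᵇ d) ∧ (b <ᵇ c) ∧ rest) → a < c × d ≤ a × b < c
  occurrence4⇒ a b c d {x} occ =
    let _ , occ₁ = ∧⁻ {x} occ; ac , occ₂ = ∧⁻ {a <ᵇ c} occ₁; da , occ₃ = ∧⁻ {not (a <ᵇ d)} occ₂
        bc , _ = ∧⁻ {b <ᵇ c} occ₃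
    in <ᵇ⇒< a c ac , T-not-<ᵇ⇒≥ da , <ᵇ⇒< b c bc

  occurrence2341⇐ : ∀ {a b c d} → a < b → a < c → d ≤ a → b < c → d ≤ b → d ≤ c →
    T (occurrence p2341 (a ∷ b ∷ c ∷ d ∷ []))
  occurrence2341⇐ a<b a<c d≤a b<c d≤b d≤c =
    ∧⁺ (<⇒<ᵇ a<b) (∧⁺ (<⇒<ᵇ a<c) (∧⁺ (≥⇒T-not-<ᵇ d≤a)
      (∧⁺ (<⇒<ᵇ b<c) (∧⁺ (≥⇒T-not-<ᵇ d≤b) (∧⁺ (≥⇒T-not-<ᵇ d≤c) _)))))

  occurrence3241⇐ : ∀ {a b c d} → b ≤ a → a < c → d ≤ a → b < c → d ≤ b → d ≤ c →
    T (occurrence p3241 (a ∷ b ∷ c ∷ d ∷ []))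
  occurrence3241⇐ b≤a a<c d≤a b<c d≤b d≤c =
    ∧⁺ (≥⇒T-not-<ᵇ b≤a) (∧⁺ (<⇒<ᵇ a<c) (∧⁺ (≥⇒T-not-<ᵇ d≤a)
      (∧⁺ (<⇒<ᵇ b<c) (∧⁺ (≥⇒T-not-<ᵇ d≤b) (∧⁺ (≥⇒T-not-<ᵇ d≤c) _)))))

  invariant132 : MaxInsertionInvariant p132
  invariant132 = record { max-first = first ; max-last = last ; top-two-first = top-two }
    where
    first : ∀ {n s} → All (_< n) s → ¬ T (occurrence p132 (n ∷ s))
    first {n} {b ∷ c ∷ []} (b<n ∷ _) occ = let n<b , _ = occurrence132⇒ n b c occ in <-asym n<b b<n
    first {s = []}                _ ()
    first {s = _ ∷ []}            _ ()
    first {s = _ ∷ _ ∷ _ ∷ _}     _ ()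
    last : ∀ {n s} → All (_< n) s → ¬ T (occurrence p132 (s ++ n ∷ []))
    last {n} {a ∷ b ∷ []} (_ ∷ b<n ∷ _) occ = let _ , _ , n≤b = occurrence132⇒ a b n occ in ≤⇒≯ n≤b b<n
    last {s = []}                 _ ()
    last {s = _ ∷ []}             _ ()
    last {s = _ ∷ _ ∷ _ ∷ []}     _ ()
    last {s = _ ∷ _ ∷ _ ∷ _ ∷ _}  _ ()
    top-two : ∀ {y n s} → y < n → All (_< y) s → ¬ T (occurrence p132 (y ∷ n ∷ s))
    top-two {y} {n} {c ∷ []} _ (c<y ∷ _) occ = let _ , y<c , _ = occurrence132⇒ y n c occ in <-asym y<c c<y
    top-two {s = []}          _ _ ()
    top-two {s = _ ∷ _ ∷ _}   _ _ ()

  invariant-xy41 : ∀ x y →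
    (∀ a b c d → T (occurrence (x ∷ y ∷ 4 ∷ 1 ∷ []) (a ∷ b ∷ c ∷ d ∷ [])) → a < c × d ≤ a × b < c) →
    MaxInsertionInvariant (x ∷ y ∷ 4 ∷ 1 ∷ [])
  invariant-xy41 x y decode = record { max-first = first ; max-last = last ; top-two-first = top-two }
    where
    σ = x ∷ y ∷ 4 ∷ 1 ∷ []
    first : ∀ {n s} → All (_< n) s → ¬ T (occurrence σ (n ∷ s))
    first {n} {b ∷ c ∷ d ∷ []} (_ ∷ c<n ∷ _) occ = let n<c , _ = decode n b c d occ in <-asym n<c c<n
    first {s = []}                _ ()
    first {s = _ ∷ []}            _ ()
    first {s = _ ∷ _ ∷ []}        _ ()
    first {s = _ ∷ _ ∷ _ ∷ _ ∷ _} _ ()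
    last : ∀ {n s} → All (_< n) s → ¬ T (occurrence σ (s ++ n ∷ []))
    last {n} {a ∷ b ∷ c ∷ []} (a<n ∷ _) occ = let _ , n≤a , _ = decode a b c n occ in ≤⇒≯ n≤a a<n
    last {s = []}                     _ ()
    last {s = _ ∷ []}                 _ ()
    last {s = _ ∷ _ ∷ []}             _ ()
    last {s = _ ∷ _ ∷ _ ∷ _ ∷ []}     _ ()
    last {s = _ ∷ _ ∷ _ ∷ _ ∷ _ ∷ _}  _ ()
    top-two : ∀ {y n s} → y < n → All (_< y) s → ¬ T (occurrence σ (y ∷ n ∷ s))
    top-two {y} {n} {c ∷ d ∷ []} y<n (c<y ∷ _) occ = let _ , _ , n<c = decode y n c d occ in <-asym n<c (<-trans c<y y<n)
    top-two {s = []}            _ _ ()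
    top-two {s = _ ∷ []}        _ _ ()
    top-two {s = _ ∷ _ ∷ _ ∷ _} _ _ ()

  invariant2341 : MaxInsertionInvariant p2341
  invariant2341 = invariant-xy41 2 3 (λ a b c d → occurrence4⇒ a b c d {a <ᵇ b})

  invariant3241 : MaxInsertionInvariant p3241
  invariant3241 = invariant-xy41 3 2 (λ a b c d → occurrence4⇒ a b c d {not (a <ᵇ b)})

  inP132-≡ : ∀ π π′ →
    contains p132 π ≡ contains p132 π′ → contains p2341 π ≡ contains p2341 π′ →
    contains p3241 π ≡ contains p3241 π′ → inP132 π ≡ inP132 π′
  inP132-≡ π π′ e₁ e₂ e₃ = cong₂ (λ c₁ c → not c₁ ∧ c) e₁ (cong₂ (λ c₂ c₃ → not c₂ ∧ not c₃) e₂ e₃)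

  inP132-insert-first : ∀ {n π} → All (_< n) π → inP132 (n ∷ π) ≡ inP132 π
  inP132-insert-first {n} {π} π<n = inP132-≡ (n ∷ π) π
    (contains-insert-first invariant132 π<n) (contains-insert-first invariant2341 π<n)
    (contains-insert-first invariant3241 π<n)

  inP132-insert-last : ∀ {n π} → All (_< n) π → inP132 (π ++ n ∷ []) ≡ inP132 π
  inP132-insert-last {n} {π} π<n = inP132-≡ (π ++ n ∷ []) π
    (contains-insert-last invariant132 π<n) (contains-insert-last invariant2341 π<n)
    (contains-insert-last invariant3241 π<n)

  inP132-insert-after-max : ∀ {y n π} → y < n → All (_< y) π → inP132 (y ∷ n ∷ π) ≡ inP132 π
  inP132-insert-after-max {y} {n} {π} y<n π<y = inP132-≡ (y ∷ n ∷ π) π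
    (contains-insert-after-max invariant132 y<n π<y) (contains-insert-after-max invariant2341 y<n π<y)
    (contains-insert-after-max invariant3241 y<n π<y)

  ContainsForbidden : List ℕ → Set
  ContainsForbidden π = T (contains p132 π) ⊎ T (contains p2341 π) ⊎ T (contains p3241 π)

  ∉P132 : ∀ π → ContainsForbidden π → inP132 π ≡ false
  ∉P132 π c with contains p132 π | contains p2341 π | contains p3241 π
  ∉P132 _ _                | true  | _     | _     = refl
  ∉P132 _ _                | false | true  | _     = refl
  ∉P132 _ _                | false | false | true  = refl
  ∉P132 _ (inj₁ ())        | false | false | false
  ∉P132 _ (inj₂ (inj₁ ())) | false | false | false
  ∉P132 _ (inj₂ (inj₂ ())) | false | false | false

  inP132-insert-after-nonmax : ∀ {t m n ρ} → t < m → m < n → m ∈ ρ → inP132 (t ∷ n ∷ ρ) ≡ false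
  inP132-insert-after-nonmax {t} {n = n} {ρ} t<m m<n m∈ρ = ∉P132 (t ∷ n ∷ ρ) (inj₁
    (contains⁺ p132 (t ∷ n ∷ ρ) (refl ∷ refl ∷ from∈ m∈ρ) (occurrence132⇐ (<-trans t<m m<n) t<m (<⇒≤ m<n))))

  two-then-max-then-smaller : ∀ {u v n z ρ} → n ∷ z ∷ [] ⊆ ρ → u < n → v < n → z < n →
    ContainsForbidden (u ∷ v ∷ ρ)
  two-then-max-then-smaller {u} {v} {n} {z} {ρ} nz u<n v<n z<n with u <? z | v <? z | u <? v
  ... | yes u<z | _       | _       =
    inj₁ (contains⁺ p132 (u ∷ v ∷ ρ) (refl ∷ v ∷ʳ nz) (occurrence132⇐ u<n u<z (<⇒≤ z<n)))
  ... | no u≮z  | yes v<z | _       =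
    inj₁ (contains⁺ p132 (u ∷ v ∷ ρ) (u ∷ʳ refl ∷ nz) (occurrence132⇐ v<n v<z (<⇒≤ z<n)))
  ... | no u≮z  | no v≮z  | yes u<v = inj₂ (inj₁ (contains⁺ p2341 (u ∷ v ∷ ρ) (refl ∷ refl ∷ nz)
    (occurrence2341⇐ u<v u<n (≮⇒≥ u≮z) v<n (≮⇒≥ v≮z) (<⇒≤ z<n))))
  ... | no u≮z  | no v≮z  | no u≮v  = inj₂ (inj₂ (contains⁺ p3241 (u ∷ v ∷ ρ) (refl ∷ refl ∷ nz)
    (occurrence3241⇐ (≮⇒≥ u≮v) u<n (≮⇒≥ u≮z) v<n (≮⇒≥ v≮z) (<⇒≤ z<n))))

  inP132-insert-inner : ∀ {u v n z} w zs → u < n → v < n → z < n → inP132 (u ∷ v ∷ w ++ n ∷ z ∷ zs) ≡ false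
  inP132-insert-inner {u} {v} {n} {z} w zs u<n v<n z<n =
    ∉P132 (u ∷ v ∷ w ++ n ∷ z ∷ zs) (two-then-max-then-smaller (++⁺ˡ w (refl ∷ refl ∷ minimum zs)) u<n v<n z<n)

  all-<ᵇ : ∀ {n π} → All (_< n) π → all (_<ᵇ n) π ≡ true
  all-<ᵇ []           = refl
  all-<ᵇ (x<n ∷ π<n) = cong₂ _∧_ (T-≡ .to (<⇒<ᵇ x<n)) (all-<ᵇ π<n)

  all-++-∷ʳ : ∀ (p : ℕ → Bool) π {n} → p n ≡ false → all p (π ++ n ∷ []) ≡ false
  all-++-∷ʳ p []      pn≡false = cong (_∧ true) pn≡false
  all-++-∷ʳ p (x ∷ π) pn≡false = trans (cong (p x ∧_) (all-++-∷ʳ p π pn≡false)) (∧-zeroʳ (p x))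

  rmax-insert-first : ∀ {n π} → All (_< n) π → rmax (n ∷ π) ≡ suc (rmax π)
  rmax-insert-first {π = π} π<n = cong (λ b → (if b then 1 else 0) + rmax π) (all-<ᵇ π<n)

  <⇒≯ᵇ : ∀ {x n} → x < n → (n <ᵇ x) ≡ false
  <⇒≯ᵇ x<n = T-not-≡ .to (≥⇒T-not-<ᵇ (<⇒≤ x<n))

  rmax-insert-last : ∀ {n} π → All (_< n) π → rmax (π ++ n ∷ []) ≡ 1
  rmax-insert-last []      []           = refl
  rmax-insert-last (x ∷ π) (x<n ∷ π<n) =
    trans (cong (λ b → (if b then 1 else 0) + rmax (π ++ _ ∷ [])) (all-++-∷ʳ (_<ᵇ x) π (<⇒≯ᵇ x<n)))
          (rmax-insert-last π π<n)

  rmax-insert-second : ∀ {y n π} → y < n → All (_< n) π → rmax (y ∷ n ∷ π) ≡ suc (rmax π)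
  rmax-insert-second {y} {n} {π} y<n π<n =
    trans (cong (λ b → (if b ∧ all (_<ᵇ y) π then 1 else 0) + rmax (n ∷ π)) (<⇒≯ᵇ y<n)) (rmax-insert-first π<n)


module Counting where

  open Patterns
  open import Data.Bool using (Bool; true; false; _∧_)
  open import Data.Bool.Properties using (∧-zeroʳ)
  open import Data.List using (List; []; _∷_; _++_; map; concatMap; filterᵇ; length)
  open import Data.List.Membership.Propositional using (_∈_)
  open import Data.List.Properties using (++-assoc; ++-identityʳ)
  open import Data.List.Relation.Unary.All as All using (All; []; _∷_)
  open import Data.List.Relation.Unary.All.Properties using (++⁺; gmap⁺; concat⁺)
  open import Data.List.Relation.Unary.Any using (here; there)
  open import Data.Nat using (zero; suc; _+_; _<_; _≡ᵇ_)
  open import Data.Nat.Properties using (+-assoc; +-identityʳ; <-trans; n<1+n)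
  open import Data.Nat.Tactic.RingSolver using (solve-∀)
  open import Data.Product using (∃₂; _,_)
  open import Function using (_∘_)
  open import Relation.Binary.PropositionalEquality using (refl; sym; trans; cong; cong₂; module ≡-Reasoning)

  private
    variable
      A B : Set

  ∑ : List A → (A → ℕ) → ℕ
  ∑ []       f = 0
  ∑ (x ∷ xs) f = f x + ∑ xs f

  syntax ∑ xs (λ x → e) = ∑[ x ∈ xs ] e

  ∑-++ : ∀ (xs ys : List A) f → ∑ (xs ++ ys) f ≡ ∑ xs f + ∑ ys f
  ∑-++ []       ys f = refl
  ∑-++ (x ∷ xs) ys f = trans (cong (f x +_) (∑-++ xs ys f)) (sym (+-assoc (f x) _ _))

  ∑-concatMap : ∀ (g : A → List B) xs f → ∑ (concatMap g xs) f ≡ ∑[ x ∈ xs ] ∑ (g x) f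
  ∑-concatMap g []       f = refl
  ∑-concatMap g (x ∷ xs) f = trans (∑-++ (g x) (concatMap g xs) f) (cong (∑ (g x) f +_) (∑-concatMap g xs f))

  ∑-map : ∀ (g : A → B) xs f → ∑ (map g xs) f ≡ ∑ xs (f ∘ g)
  ∑-map g []       f = refl
  ∑-map g (x ∷ xs) f = cong (f (g x) +_) (∑-map g xs f)

  ∑-+ : ∀ (xs : List A) f g → ∑[ x ∈ xs ] (f x + g x) ≡ ∑ xs f + ∑ xs g
  ∑-+ []       f g = refl
  ∑-+ (x ∷ xs) f g = trans (cong (f x + g x +_) (∑-+ xs f g)) (interchange (f x) (g x) _ _)
    where
    interchange : ∀ a b c d → a + b + (c + d) ≡ a + c + (b + d)
    interchange = solve-∀

  ∑-cong : ∀ (xs : List A) {f g} → (∀ {x} → x ∈ xs → f x ≡ g x) → ∑ xs f ≡ ∑ xs g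
  ∑-cong []       f≡g = refl
  ∑-cong (x ∷ xs) f≡g = cong₂ _+_ (f≡g (here refl)) (∑-cong xs (f≡g ∘ there))

  ∑-zero : ∀ (xs : List A) {f} → (∀ {x} → x ∈ xs → f x ≡ 0) → ∑ xs f ≡ 0
  ∑-zero []       f≡0 = refl
  ∑-zero (x ∷ xs) f≡0 = cong₂ _+_ (f≡0 (here refl)) (∑-zero xs (f≡0 ∘ there))

  𝕀 : Bool → ℕ
  𝕀 true  = 1
  𝕀 false = 0

  count : (A → Bool) → List A → ℕ
  count p xs = length (filterᵇ p xs)

  count≡∑ : ∀ (p : A → Bool) xs → count p xs ≡ ∑[ x ∈ xs ] 𝕀 (p x)
  count≡∑ p []       = refl
  count≡∑ p (x ∷ xs) with p x
  ... | true  = cong suc (count≡∑ p xs)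
  ... | false = count≡∑ p xs

  insertions-All : ∀ {P : ℕ → Set} {n} π → P n → All P π → All (All P) (insertions n π)
  insertions-All []      pn []         = (pn ∷ []) ∷ []
  insertions-All (x ∷ π) pn (px ∷ pxs) = (pn ∷ px ∷ pxs) ∷ gmap⁺ (px ∷_) (insertions-All π pn pxs)

  insertions-∋ : ∀ n π → All (n ∈_) (insertions n π)
  insertions-∋ n []      = here refl ∷ []
  insertions-∋ n (x ∷ π) = here refl ∷ gmap⁺ there (insertions-∋ n π)

  insertions-nonempty : ∀ n π → All (λ σ → ∃₂ λ y τ → σ ≡ y ∷ τ) (insertions n π)
  insertions-nonempty n []      = (n , [] , refl) ∷ []
  insertions-nonempty n (x ∷ π) = (n , x ∷ π , refl) ∷ gmap⁺ (λ {σ} _ → x , σ , refl) (insertions-nonempty n π)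

  perms-bounded : ∀ n → All (All (_< n)) (perms n)
  perms-bounded zero    = [] ∷ []
  perms-bounded (suc n) = concat⁺ (gmap⁺ (λ {π} π<n → insertions-All π (n<1+n n) (All.map widen π<n)) (perms-bounded n))
    where
    widen : ∀ {x} → x < n → x < suc n
    widen x<n = <-trans x<n (n<1+n n)

  perms-nonempty : ∀ n → All (λ σ → ∃₂ λ y τ → σ ≡ y ∷ τ) (perms (suc n))
  perms-nonempty n = concat⁺ (gmap⁺ (λ {π} _ → insertions-nonempty n π) (perms-bounded n))

  counted : (ℕ → Bool) → List ℕ → Bool
  counted R π = inP132 π ∧ R (rmax π)

  -- a n k = #P (_≡ᵇ k) n  definitionally
  #P : (ℕ → Bool) → ℕ → ℕ
  #P R n = count (counted R) (perms n)

  #P₊ : (ℕ → Bool) → ℕ → ℕ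
  #P₊ R zero    = 0
  #P₊ R (suc n) = #P R (suc n)

  ∣P∣ : ℕ → ℕ
  ∣P∣ = #P (λ _ → true)

  counted-insert-first : ∀ R {n π} → All (_< n) π → counted R (n ∷ π) ≡ counted (R ∘ suc) π
  counted-insert-first R π<n = cong₂ _∧_ (inP132-insert-first π<n) (cong R (rmax-insert-first π<n))

  counted-insert-last : ∀ R {n} π → All (_< n) π → counted R (π ++ n ∷ []) ≡ counted (λ _ → R 1) π
  counted-insert-last R π π<n = cong₂ _∧_ (inP132-insert-last π<n) (cong R (rmax-insert-last π π<n))

  counted-insert-after-max : ∀ R {y n π} → y < n → All (_< y) π → counted R (y ∷ n ∷ π) ≡ counted (R ∘ suc) π
  counted-insert-after-max R y<n π<y = cong₂ _∧_ (inP132-insert-after-max y<n π<y)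
    (cong R (rmax-insert-second y<n (All.map (λ z<y → <-trans z<y y<n) π<y)))

  count-deep-insertions : ∀ R {n u v} w ys → u < n → v < n → All (_< n) w → All (_< n) ys →
    ∑[ ρ ∈ insertions n ys ] 𝕀 (counted R (u ∷ v ∷ w ++ ρ)) ≡ 𝕀 (counted (λ _ → R 1) (u ∷ v ∷ w ++ ys))
  count-deep-insertions R {n} {u} {v} w [] u<n v<n w<n [] = trans (+-identityʳ _) (cong 𝕀 (begin
    counted R ((u ∷ v ∷ w) ++ n ∷ [])    ≡⟨ counted-insert-last R (u ∷ v ∷ w) (u<n ∷ v<n ∷ w<n) ⟩
    counted (λ _ → R 1) (u ∷ v ∷ w)      ≡⟨ cong (λ ρ → counted (λ _ → R 1) (u ∷ v ∷ ρ)) (sym (++-identityʳ w)) ⟩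
    counted (λ _ → R 1) (u ∷ v ∷ w ++ []) ∎))
    where open ≡-Reasoning
  count-deep-insertions R {n} {u} {v} w (z ∷ zs) u<n v<n w<n (z<n ∷ zs<n) = begin
    𝕀 (counted R (u ∷ v ∷ w ++ n ∷ z ∷ zs)) + ∑[ ρ ∈ map (z ∷_) (insertions n zs) ] 𝕀 (counted R (u ∷ v ∷ w ++ ρ))
      ≡⟨ cong₂ _+_ (cong (λ b → 𝕀 (b ∧ R (rmax (u ∷ v ∷ w ++ n ∷ z ∷ zs)))) (inP132-insert-inner w zs u<n v<n z<n))
                   (∑-map (z ∷_) (insertions n zs) (λ ρ → 𝕀 (counted R (u ∷ v ∷ w ++ ρ)))) ⟩
    ∑[ ρ ∈ insertions n zs ] 𝕀 (counted R (u ∷ v ∷ w ++ z ∷ ρ))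
      ≡⟨ ∑-cong (insertions n zs) (λ {ρ} _ → cong (λ τ → 𝕀 (counted R (u ∷ v ∷ τ))) (sym (++-assoc w (z ∷ []) ρ))) ⟩
    ∑[ ρ ∈ insertions n zs ] 𝕀 (counted R (u ∷ v ∷ (w ++ z ∷ []) ++ ρ))
      ≡⟨ count-deep-insertions R (w ++ z ∷ []) zs u<n v<n (++⁺ w<n (z<n ∷ [])) zs<n ⟩
    𝕀 (counted (λ _ → R 1) (u ∷ v ∷ (w ++ z ∷ []) ++ zs))
      ≡⟨ cong (λ τ → 𝕀 (counted (λ _ → R 1) (u ∷ v ∷ τ))) (++-assoc w (z ∷ []) zs) ⟩
    𝕀 (counted (λ _ → R 1) (u ∷ v ∷ w ++ z ∷ zs)) ∎
    where open ≡-Reasoning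

  -- for a one-entry σ the second slot is the last one, which count-insertions counts separately
  secondSlot : (ℕ → Bool) → ℕ → List ℕ → ℕ
  secondSlot R n (y ∷ z ∷ zs) = 𝕀 (counted R (y ∷ n ∷ z ∷ zs))
  secondSlot R n _            = 0

  count-insertions : ∀ R {n} y τ → All (_< n) (y ∷ τ) →
    ∑[ ρ ∈ insertions n (y ∷ τ) ] 𝕀 (counted R ρ)
      ≡ 𝕀 (counted (R ∘ suc) (y ∷ τ)) + 𝕀 (counted (λ _ → R 1) (y ∷ τ)) + secondSlot R n (y ∷ τ)
  count-insertions R y [] yτ<n =
    trans (cong₂ (λ a b → 𝕀 a + (𝕀 b + 0)) (counted-insert-first R yτ<n) (counted-insert-last R (y ∷ []) yτ<n))
          (sym (+-assoc (𝕀 (counted (R ∘ suc) (y ∷ []))) (𝕀 (counted (λ _ → R 1) (y ∷ []))) 0))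
  count-insertions R {n} y (z ∷ zs) (y<n ∷ z<n ∷ zs<n) = begin
    𝕀 (counted R (n ∷ σ)) + (inSecond + ∑ (map (y ∷_) (map (z ∷_) (insertions n zs))) f)
      ≡⟨ cong₂ (λ a t → 𝕀 a + (inSecond + t)) (counted-insert-first R (y<n ∷ z<n ∷ zs<n)) deep ⟩
    𝕀 (counted (R ∘ suc) σ) + (inSecond + 𝕀 (counted (λ _ → R 1) σ))
      ≡⟨ swap (𝕀 (counted (R ∘ suc) σ)) inSecond (𝕀 (counted (λ _ → R 1) σ)) ⟩
    𝕀 (counted (R ∘ suc) σ) + 𝕀 (counted (λ _ → R 1) σ) + inSecond ∎
    where
    open ≡-Reasoning
    σ = y ∷ z ∷ zs
    inSecond = 𝕀 (counted R (y ∷ n ∷ z ∷ zs))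
    f : List ℕ → ℕ
    f ρ = 𝕀 (counted R ρ)
    deep : ∑ (map (y ∷_) (map (z ∷_) (insertions n zs))) f ≡ 𝕀 (counted (λ _ → R 1) σ)
    deep = trans (∑-map (y ∷_) (map (z ∷_) (insertions n zs)) f)
      (trans (∑-map (z ∷_) (insertions n zs) (f ∘ (y ∷_))) (count-deep-insertions R [] zs y<n z<n [] zs<n))
    swap : ∀ a e t → a + (e + t) ≡ a + t + e
    swap = solve-∀

  -- only the insertion right after the old maximum (at the front) survives
  secondSlot-insertions : ∀ R {m} t ts → All (_< suc m) (t ∷ ts) →
    ∑[ σ ∈ insertions (suc m) (t ∷ ts) ] secondSlot R (suc (suc m)) σ ≡ 𝕀 (counted (R ∘ suc) (t ∷ ts))
  secondSlot-insertions R {m} t ts (t<m ∷ ts<m) = begin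
    𝕀 (counted R (suc m ∷ suc (suc m) ∷ t ∷ ts)) + ∑ (map (t ∷_) (insertions (suc m) ts)) (secondSlot R (suc (suc m)))
      ≡⟨ cong₂ (λ b c → 𝕀 b + c) (counted-insert-after-max R (n<1+n (suc m)) (t<m ∷ ts<m)) later ⟩
    𝕀 (counted (R ∘ suc) (t ∷ ts)) + 0
      ≡⟨ +-identityʳ _ ⟩
    𝕀 (counted (R ∘ suc) (t ∷ ts)) ∎
    where
    open ≡-Reasoning
    dead : ∀ {ρ} → ρ ∈ insertions (suc m) ts → secondSlot R (suc (suc m)) (t ∷ ρ) ≡ 0
    dead ρ∈ with All.lookup (insertions-nonempty (suc m) ts) ρ∈
    ... | z , zs , refl = cong (λ b → 𝕀 (b ∧ R (rmax (t ∷ suc (suc m) ∷ z ∷ zs))))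
      (inP132-insert-after-nonmax t<m (n<1+n (suc m)) (All.lookup (insertions-∋ (suc m) ts) ρ∈))
    later : ∑ (map (t ∷_) (insertions (suc m) ts)) (secondSlot R (suc (suc m))) ≡ 0
    later = trans (∑-map (t ∷_) (insertions (suc m) ts) _) (∑-zero (insertions (suc m) ts) dead)

  ∑-secondSlot : ∀ R n → ∑[ σ ∈ perms (suc n) ] secondSlot R (suc n) σ ≡ #P₊ (R ∘ suc) n
  ∑-secondSlot R zero    = refl
  ∑-secondSlot R (suc m) = begin
    ∑[ σ ∈ perms (suc (suc m)) ] secondSlot R (suc (suc m)) σ
      ≡⟨ ∑-concatMap (insertions (suc m)) (perms (suc m)) (secondSlot R (suc (suc m))) ⟩
    ∑[ τ ∈ perms (suc m) ] ∑[ σ ∈ insertions (suc m) τ ] secondSlot R (suc (suc m)) σ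
      ≡⟨ ∑-cong (perms (suc m)) per-τ ⟩
    ∑[ τ ∈ perms (suc m) ] 𝕀 (counted (R ∘ suc) τ)
      ≡⟨ sym (count≡∑ (counted (R ∘ suc)) (perms (suc m))) ⟩
    #P (R ∘ suc) (suc m) ∎
    where
    open ≡-Reasoning
    per-τ : ∀ {τ} → τ ∈ perms (suc m) →
      ∑[ σ ∈ insertions (suc m) τ ] secondSlot R (suc (suc m)) σ ≡ 𝕀 (counted (R ∘ suc) τ)
    per-τ τ∈ with All.lookup (perms-nonempty m) τ∈ | All.lookup (perms-bounded (suc m)) τ∈
    ... | t , ts , refl | τ<m = secondSlot-insertions R t ts τ<m

  #P-rec : ∀ R n → #P R (suc (suc n)) ≡ #P (R ∘ suc) (suc n) + #P (λ _ → R 1) (suc n) + #P₊ (R ∘ suc) n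
  #P-rec R n = begin
    #P R (suc (suc n))
      ≡⟨ count≡∑ (counted R) (perms (suc (suc n))) ⟩
    ∑[ σ ∈ concatMap (insertions (suc n)) (perms (suc n)) ] 𝕀 (counted R σ)
      ≡⟨ ∑-concatMap (insertions (suc n)) (perms (suc n)) (𝕀 ∘ counted R) ⟩
    ∑[ τ ∈ perms (suc n) ] ∑[ σ ∈ insertions (suc n) τ ] 𝕀 (counted R σ)
      ≡⟨ ∑-cong (perms (suc n)) per-τ ⟩
    ∑[ τ ∈ perms (suc n) ] (front τ + back τ + secondSlot R (suc n) τ)
      ≡⟨ ∑-+ (perms (suc n)) (λ τ → front τ + back τ) (secondSlot R (suc n)) ⟩
    ∑[ τ ∈ perms (suc n) ] (front τ + back τ) + ∑[ τ ∈ perms (suc n) ] secondSlot R (suc n) τ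
      ≡⟨ cong₂ _+_ (∑-+ (perms (suc n)) front back) (∑-secondSlot R n) ⟩
    ∑ (perms (suc n)) front + ∑ (perms (suc n)) back + #P₊ (R ∘ suc) n
      ≡⟨ cong₂ (λ a b → a + b + #P₊ (R ∘ suc) n)
               (sym (count≡∑ (counted (R ∘ suc)) (perms (suc n)))) (sym (count≡∑ (counted (λ _ → R 1)) (perms (suc n)))) ⟩
    #P (R ∘ suc) (suc n) + #P (λ _ → R 1) (suc n) + #P₊ (R ∘ suc) n ∎
    where
    open ≡-Reasoning
    front back : List ℕ → ℕ
    front τ = 𝕀 (counted (R ∘ suc) τ)
    back  τ = 𝕀 (counted (λ _ → R 1) τ)
    per-τ : ∀ {τ} → τ ∈ perms (suc n) →
      ∑[ σ ∈ insertions (suc n) τ ] 𝕀 (counted R σ) ≡ front τ + back τ + secondSlot R (suc n) τ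
    per-τ τ∈ with All.lookup (perms-nonempty n) τ∈ | All.lookup (perms-bounded (suc n)) τ∈
    ... | y , τ′ , refl | τ<n = count-insertions R y τ′ τ<n

  #P-false : ∀ R n → (∀ r → R r ≡ false) → #P R n ≡ 0
  #P-false R n R≡false = trans (count≡∑ (counted R) (perms n))
    (∑-zero (perms n) (λ {π} _ → cong 𝕀 (trans (cong (inP132 π ∧_) (R≡false (rmax π))) (∧-zeroʳ (inP132 π)))))

  #P₊-rmax-zero : ∀ n → #P₊ (_≡ᵇ 0) n ≡ 0
  #P₊-rmax-zero zero          = refl
  #P₊-rmax-zero (suc zero)    = refl
  #P₊-rmax-zero (suc (suc n)) = trans (#P-rec (_≡ᵇ 0) n)
    (cong₂ _+_ (cong₂ _+_ (#P-false _ (suc n) (λ _ → refl)) (#P-false _ (suc n) (λ _ → refl))) (#P₊-false n))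
    where
    #P₊-false : ∀ n → #P₊ (λ r → suc r ≡ᵇ 0) n ≡ 0
    #P₊-false zero    = refl
    #P₊-false (suc n) = #P-false _ (suc n) (λ _ → refl)

  ∣P∣-rec : ∀ n → ∣P∣ (suc (suc (suc n))) ≡ ∣P∣ (suc (suc n)) + ∣P∣ (suc (suc n)) + ∣P∣ (suc n)
  ∣P∣-rec n = #P-rec (λ _ → true) (suc n)


module GeneratingFunctions where

  open PowerSeries
  open Counting
  open import Data.Nat using (zero; suc; _≡ᵇ_)
  import Data.Nat as ℕ
  open import Data.Integer using (+_; _+_; _-_)
  open import Data.Integer.Properties using (+-identityʳ; pos-+)
  open import Data.Integer.Tactic.RingSolver using (solve-∀)
  open import Relation.Binary.PropositionalEquality using (refl; trans; cong; cong₂; module ≡-Reasoning)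

  F⊖𝟙≡#P₊ : ∀ n k → (F ⊖ 𝟙) n k ≡ + #P₊ (_≡ᵇ k) n
  F⊖𝟙≡#P₊ zero    zero    = refl
  F⊖𝟙≡#P₊ zero    (suc k) = refl
  F⊖𝟙≡#P₊ (suc n) k       = +-identityʳ _

  Sizes : Ser
  Sizes n zero    = + ∣P∣ n
  Sizes n (suc k) = + 0

  Sizes≡#P : ∀ n k → + #P (λ _ → 0 ≡ᵇ k) n ≡ Sizes n k
  Sizes≡#P n zero    = refl
  Sizes≡#P n (suc k) = cong +_ (#P-false _ n (λ _ → refl))

  mulD₂-Sizes : mulD₂ Sizes ≈ 𝟙 ⊖ mulX 𝟙 ⊖ mulX (mulX 𝟙)
  mulD₂-Sizes zero                zero    = refl
  mulD₂-Sizes (suc zero)          zero    = refl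
  mulD₂-Sizes (suc (suc zero))    zero    = refl
  mulD₂-Sizes (suc (suc (suc n))) zero    = vanish (∣P∣ (suc (suc n))) (∣P∣ (suc n)) (∣P∣-rec n)
    where
    vanish : ∀ {a} b c → a ≡ b ℕ.+ b ℕ.+ c → + a - (+ b + + b) - + c ≡ + 0
    vanish b c refl = trans (cong (λ x → x - (+ b + + b) - + c) (trans (pos-+ (b ℕ.+ b) c) (cong (_+ + c) (pos-+ b b))))
                                    (cancel (+ b) (+ c))
      where
      cancel : ∀ b c → b + b + c - (b + b) - c ≡ + 0
      cancel = solve-∀
  mulD₂-Sizes zero                (suc k) = refl
  mulD₂-Sizes (suc zero)          (suc k) = refl
  mulD₂-Sizes (suc (suc zero))    (suc k) = refl
  mulD₂-Sizes (suc (suc (suc n))) (suc k) = refl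

  mulD₁-F⊖𝟙 : mulD₁ (F ⊖ 𝟙) ≈ mulX (mulY Sizes)
  mulD₁-F⊖𝟙 zero          zero          = refl
  mulD₁-F⊖𝟙 zero          (suc k)       = refl
  mulD₁-F⊖𝟙 (suc zero)    zero          = refl
  mulD₁-F⊖𝟙 (suc zero)    (suc zero)    = refl
  mulD₁-F⊖𝟙 (suc zero)    (suc (suc k)) = refl
  mulD₁-F⊖𝟙 (suc (suc m)) zero          =
    cong (λ g → g - + 0 - + 0) (trans (F⊖𝟙≡#P₊ (suc (suc m)) zero) (cong +_ (#P₊-rmax-zero (suc (suc m)))))
  mulD₁-F⊖𝟙 (suc (suc m)) (suc k)       = begin
    (F ⊖ 𝟙) (suc (suc m)) (suc k) - (F ⊖ 𝟙) (suc m) k - (F ⊖ 𝟙) m k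
      ≡⟨ cong₂ _-_ (cong₂ _-_ (F⊖𝟙≡#P₊ (suc (suc m)) (suc k)) (F⊖𝟙≡#P₊ (suc m) k)) (F⊖𝟙≡#P₊ m k) ⟩
    + #P₊ (_≡ᵇ suc k) (suc (suc m)) - + #P₊ (_≡ᵇ k) (suc m) - + #P₊ (_≡ᵇ k) m
      ≡⟨ cong (λ x → + x - + #P₊ (_≡ᵇ k) (suc m) - + #P₊ (_≡ᵇ k) m) (#P-rec (_≡ᵇ suc k) m) ⟩
    + (#P₊ (_≡ᵇ k) (suc m) ℕ.+ #P (λ _ → 0 ≡ᵇ k) (suc m) ℕ.+ #P₊ (_≡ᵇ k) m) - + #P₊ (_≡ᵇ k) (suc m) - + #P₊ (_≡ᵇ k) m
      ≡⟨ cancel (#P₊ (_≡ᵇ k) (suc m)) (#P (λ _ → 0 ≡ᵇ k) (suc m)) (#P₊ (_≡ᵇ k) m) ⟩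
    + #P (λ _ → 0 ≡ᵇ k) (suc m)
      ≡⟨ Sizes≡#P (suc m) k ⟩
    Sizes (suc m) k ∎
    where
    open ≡-Reasoning
    cancel : ∀ a t c → + (a ℕ.+ t ℕ.+ c) - + a - + c ≡ + t
    cancel a t c = trans (cong (λ x → x - + a - + c) (trans (pos-+ (a ℕ.+ t) c) (cong (_+ + c) (pos-+ a t))))
                         (ring (+ a) (+ t) (+ c))
      where
      ring : ∀ a t c → a + t + c - a - c ≡ t
      ring = solve-∀


open PowerSeries
open GeneratingFunctions

mainTheorem14 : ∀ (n k : ℕ) →
    ((𝟙 ⊖ X ⊛ Y ⊖ X ⊛ X ⊛ Y) ⊛ (𝟙 ⊖ (X ⊕ X) ⊖ X ⊛ X) ⊛ (F ⊖ 𝟙)) n k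
    ≡ (X ⊛ Y ⊛ (𝟙 ⊖ X ⊖ X ⊛ X)) n k
mainTheorem14 = begin
  (D₁ ⊛ D₂) ⊛ G               ≈⟨ ⊛-congˡ G (D₁-⊛ D₂) ⟩
  mulD₁ D₂ ⊛ G                ≈⟨ mulD₁-⊛ D₂ G ⟩
  mulD₁ (D₂ ⊛ G)              ≈⟨ mulD₁-cong (D₂-⊛ G) ⟩
  mulD₁ (mulD₂ G)             ≈⟨ ≈-sym (mulD₂-mulD₁ G) ⟩
  mulD₂ (mulD₁ G)             ≈⟨ mulD₂-cong mulD₁-F⊖𝟙 ⟩
  mulD₂ (mulX (mulY Sizes))   ≈⟨ mulD₂-mulXY Sizes ⟩
  mulX (mulY (mulD₂ Sizes))   ≈⟨ mulX-cong (mulY-cong (≈-trans mulD₂-Sizes (≈-sym 𝟙⊖X⊖X⊛X≈))) ⟩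
  mulX (mulY (𝟙 ⊖ X ⊖ X ⊛ X)) ≈⟨ ≈-sym (XY-⊛ (𝟙 ⊖ X ⊖ X ⊛ X)) ⟩
  X ⊛ Y ⊛ (𝟙 ⊖ X ⊖ X ⊛ X) ∎
  where
  open ≈-Reasoning
  D₁ D₂ G : Ser
  D₁ = 𝟙 ⊖ X ⊛ Y ⊖ X ⊛ X ⊛ Y
  D₂ = 𝟙 ⊖ (X ⊕ X) ⊖ X ⊛ X
  G  = F ⊖ 𝟙
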